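{- Let $G=(V_1,V_2,E)$ be a game structure, $p\colon V\to\{0,\dots,d\}$ a priority function and $\lambda\in\mathbb{N}_0$. A play $\pi$ belongs to $\mathsf{FixWP}(\lambda,p)$ if and only if there exists an increasing sequence of indices $(k_i)_{i\ge 0}$ such that for every $i\ge 0$ the history $\pi[k_i,k_{i+1}-1]$ is $\lambda$-good. Likewise, $\pi$ belongs to $\mathsf{DirFixWP}(\lambda,p)$ if and only if there exists such an increasing sequence $(k_i)_{i\ge0}$ with $k_0=0$ and every $\pi[k_i,k_{i+1}-1]$ $\lambda$-good.
   Context: A game structure is $G=(V_1,V_2,E)$ where $V=V_1\cup V_2$ ($V_1\cap V_2=\emptyset$) is finite, $E\subseteq V\times V$, and every vertex has an outgoing edge. A play is an infinite sequence $\pi=v_0v_1\dots$ with $(v_k,v_{k+1})\in E$ for all $k$; $\pi[k]=v_k$, $\pi[k,l]=v_k\dots v_l$ and $\pi[k,\infty]=v_kv_{k+1}\dots$. $\mathbb{N}_0$ denotes the positive integers. A priority function is $p\colon V\to\{0,1,\dots,d\}$ with $d$ even. For priorities $c,c'$, write $c\preceq c'$ iff $c$ is even and $c\le c'$. For $\lambda\in\mathbb{N}_0$, $\mathsf{DirFixWP}(\lambda,p)=\{\pi \mid \forall j\ge0\ \exists l\in\{0,\dots,\lambda-1\}\ \forall k\in\{0,\dots,l\}:\ p(\pi[j+l])\preceq p(\pi[j+k])\}$ and $\mathsf{FixWP}(\lambda,p)=\{\pi\mid \exists i\ge0:\ \pi[i,\infty]\in\mathsf{DirFixWP}(\lambda,p)\}$.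 For a play $\pi$ and position $j$, the window at $j$ closes in $j+l$ if $l\ge0$ is the smallest integer such that $p(\pi[j+l])\preceq p(\pi[j+k])$ for all $k\in\{0,\dots,l\}$. The history $\pi[j,j+l]$ is called $\lambda$-good if the window at $j$ closes in $j+l$ and $l<\lambda$. -}

module Defs where

open import Data.Nat using (ℕ; zero; suc; _+_; _*_; _∸_; _≤_; _<_)
open import Data.Fin using (Fin)
open import Data.Bool using (Bool)
open import Data.Product using (Σ; ∃; ∃-syntax; _×_; _,_)
open import Relation.Nullary using (¬_)
open import Relation.Binary.PropositionalEquality using (_≡_)

-- A game structure G = (V₁, V₂, E) on the finite vertex set V = Fin n.
-- The partition V = V₁ ⊎ V₂ is given by an owner map (true = V₁, false = V₂).
record GameStructure : Set₁ where
  field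
    n      : ℕ
    owner  : Fin n → Bool
    E      : Fin n → Fin n → Set
    total  : ∀ v → ∃[ w ] E v w

module _ (G : GameStructure) where
  open GameStructure G

  Seq : Set
  Seq = ℕ → Fin n

  IsPlay : Seq → Set
  IsPlay π = ∀ k → E (π k) (π (suc k))

Even : ℕ → Set
Even c = ∃[ m ] c ≡ 2 * m

_⪯_ : ℕ → ℕ → Set
c ⪯ c' = Even c × c ≤ c'

module _ {n : ℕ} (p : Fin n → ℕ) where

  WindowCond : (ℕ → Fin n) → ℕ → ℕ → Set
  WindowCond π j l = ∀ k → k ≤ l → p (π (j + l)) ⪯ p (π (j + k))

  DirFixWP : ℕ → (ℕ → Fin n) → Set
  DirFixWP λ′ π = ∀ j → ∃[ l ] (l < λ′ × WindowCond π j l)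

  FixWP : ℕ → (ℕ → Fin n) → Set
  FixWP λ′ π = ∃[ i ] DirFixWP λ′ (λ t → π (i + t))

  ClosesIn : (ℕ → Fin n) → ℕ → ℕ → Set
  ClosesIn π j l = WindowCond π j l × (∀ l′ → l′ < l → ¬ WindowCond π j l′)

  -- the history π[j, j+l] is λ-good
  Good : ℕ → (ℕ → Fin n) → ℕ → ℕ → Set
  Good λ′ π j l = ClosesIn π j l × l < λ′

  -- the history π[j, e] (with j ≤ e) is λ-good, written via its end index e
  GoodHistory : ℕ → (ℕ → Fin n) → ℕ → ℕ → Set
  GoodHistory λ′ π j e = j ≤ e × Good λ′ π j (e ∸ j)

StrictlyIncreasing : (ℕ → ℕ) → Set
StrictlyIncreasing k = ∀ i → k i < k (suc i)

-- From an index a on, every window closes within λ steps iff the play from a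
-- splits into consecutive λ-good blocks.  If the window at s closes in e, then
-- p(π[e]) is even and minimal on π[s, e], so the window at every j ∈ [s, e]
-- closes in e as well, within e - s < λ steps.  Conversely, cutting the play
-- after the least closing point of each block start gives λ-good blocks.
module Submission where

open import Defs
open import Data.Nat using (ℕ; zero; suc; _+_; _*_; _≤_; _<_; _∸_; z≤n; s≤s; _≤?_)
open import Data.Nat.Properties
open import Data.Nat.Divisibility using (_∣?_; divides)
open import Data.Nat.Induction using (<-rec)
open import Data.Fin using (Fin)
open import Data.Product using (Σ; ∃; ∃-syntax; _×_; _,_; proj₁; proj₂)
open import Data.Sum using (inj₁; inj₂)
open import Function.Bundles using (_⇔_; mk⇔; Equivalence)
open import Relation.Nullary using (¬_; Dec; yes; no)
open import Relation.Nullary.Decidable using (map′; _×-dec_)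
open import Relation.Unary using (Decidable)
open import Relation.Binary.PropositionalEquality using (_≡_; refl; sym; trans; subst; subst₂)

even? : ∀ c → Dec (Even c)
even? c = map′ (λ where (divides q eq) → q , trans eq (*-comm q 2))
               (λ where (q , eq) → divides q (trans eq (*-comm 2 q)))
               (2 ∣? c)

_⪯?_ : ∀ c c′ → Dec (c ⪯ c′)
c ⪯? c′ = even? c ×-dec (c ≤? c′)

module _ {a} {P : ℕ → Set a} where

  Least : ℕ → Set a
  Least m = P m × (∀ m′ → m′ < m → ¬ P m′)

  least-witness : Decidable P → ∀ {l} → P l → ∃[ m ] (m ≤ l × Least m)
  least-witness P? {l} = <-rec (λ l → P l → ∃[ m ] (m ≤ l × Least m)) step l
    where
    step : ∀ l → (∀ {n} → n < l → P n → ∃[ m ] (m ≤ n × Least m))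
         → P l → ∃[ m ] (m ≤ l × Least m)
    step l rec Pl with anyUpTo? P? l
    ... | yes (n , n<l , Pn) = let m , m≤n , least = rec n<l Pn
                               in m , ≤-trans m≤n (<⇒≤ n<l) , least
    ... | no none            = l , ≤-refl , Pl , λ m′ m′<l Pm′ → none (m′ , m′<l , Pm′)

block-containing : ∀ {k} → StrictlyIncreasing k →
                   ∀ {j} → k 0 ≤ j → ∃[ i ] (k i ≤ j × j < k (suc i))
block-containing {k} inc {zero} k0≤0 = 0 , k0≤0 , ≤-<-trans z≤n (inc 0)
block-containing {k} inc {suc j} k0≤1+j with m≤n⇒m<n∨m≡n k0≤1+j
... | inj₂ k0≡1+j = 0 , k0≤1+j , subst (_< k 1) k0≡1+j (inc 0)
... | inj₁ k0<1+j with block-containing inc (≤-pred k0<1+j)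
...   | i , ki≤j , j<ki+1 with m≤n⇒m<n∨m≡n j<ki+1
...     | inj₁ 1+j<ki+1 = i , m≤n⇒m≤1+n ki≤j , 1+j<ki+1
...     | inj₂ 1+j≡ki+1 = suc i , ≤-reflexive (sym 1+j≡ki+1)
                        , subst (_< k (suc (suc i))) (sym 1+j≡ki+1) (inc (suc i))

windowCond-shift : ∀ {n} (p : Fin n → ℕ) (π : ℕ → Fin n) i j l →
                   WindowCond p (λ t → π (i + t)) j l ⇔ WindowCond p π (i + j) l
windowCond-shift p π i j l = mk⇔
  (λ wc m m≤l → subst₂ ⪯-at (sym (+-assoc i j l)) (sym (+-assoc i j m)) (wc m m≤l))
  (λ wc m m≤l → subst₂ ⪯-at (+-assoc i j l) (+-assoc i j m) (wc m m≤l))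
  where
  ⪯-at : ℕ → ℕ → Set
  ⪯-at x y = p (π x) ⪯ p (π y)

module _ {n : ℕ} (p : Fin n → ℕ) (λ′ : ℕ) (π : ℕ → Fin n) where

  ClosesWithin : ℕ → Set
  ClosesWithin j = ∃[ l ] (l < λ′ × WindowCond p π j l)

  ClosesFrom : ℕ → Set
  ClosesFrom a = ∀ j → a ≤ j → ClosesWithin j

  GoodBlocks : (ℕ → ℕ) → Set
  GoodBlocks k = ∀ i → GoodHistory p λ′ π (k i) (k (suc i) ∸ 1)

  windowCond? : ∀ j l → Dec (WindowCond p π j l)
  windowCond? j l =
    map′ (λ all k k≤l → all (s≤s k≤l)) (λ wc {k} k<1+l → wc k (≤-pred k<1+l))
         (allUpTo? (λ k → p (π (j + l)) ⪯? p (π (j + k))) (suc l))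

  closesWithin⇒good : ∀ {j} → ClosesWithin j → ∃[ l ] Good p λ′ π j l
  closesWithin⇒good {j} (l , l<λ , wc) =
    let m , m≤l , closes = least-witness (windowCond? j) wc
    in m , closes , ≤-<-trans m≤l l<λ

  good⇒goodHistory : ∀ {j l} → Good p λ′ π j l → GoodHistory p λ′ π j (j + l)
  good⇒goodHistory {j} {l} good =
    m≤m+n j l , subst (Good p λ′ π j) (sym (m+n∸m≡n j l)) good

  goodHistory-end-⪯ : ∀ {s e t} → GoodHistory p λ′ π s e →
                      s ≤ t → t ≤ e → p (π e) ⪯ p (π t)
  goodHistory-end-⪯ {s} {e} {t} (s≤e , (wc , _) , _) s≤t t≤e =
    subst₂ (λ x y → p (π x) ⪯ p (π y)) (m+[n∸m]≡n s≤e) (m+[n∸m]≡n s≤t)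
           (wc (t ∸ s) (∸-monoˡ-≤ s t≤e))

  goodHistory⇒closesWithin : ∀ {s e j} → GoodHistory p λ′ π s e →
                             s ≤ j → j ≤ e → ClosesWithin j
  goodHistory⇒closesWithin {s} {e} {j} h@(_ , _ , e∸s<λ) s≤j j≤e =
    e ∸ j , ≤-<-trans (∸-monoʳ-≤ e s≤j) e∸s<λ , wc
    where
    wc : WindowCond p π j (e ∸ j)
    wc m m≤e∸j = subst (λ x → p (π x) ⪯ p (π (j + m))) (sym (m+[n∸m]≡n j≤e))
                       (goodHistory-end-⪯ h (≤-trans s≤j (m≤m+n j m)) j+m≤e)
      where
      j+m≤e : j + m ≤ e
      j+m≤e = ≤-trans (+-monoʳ-≤ j m≤e∸j) (≤-reflexive (m+[n∸m]≡n j≤e))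

  goodBlocks⇒closesFrom : ∀ {k} → StrictlyIncreasing k → GoodBlocks k → ClosesFrom (k 0)
  goodBlocks⇒closesFrom inc good j k0≤j =
    let i , ki≤j , j<ki+1 = block-containing inc k0≤j
    in goodHistory⇒closesWithin (good i) ki≤j (<⇒≤pred j<ki+1)

  module _ {a} (closes : ClosesFrom a) where

    blockLength : ∀ j → a ≤ j → ℕ
    blockLength j a≤j = proj₁ (closesWithin⇒good (closes j a≤j))

    blockStart : ℕ → Σ ℕ (a ≤_)
    blockStart zero    = a , ≤-refl
    blockStart (suc i) =
      let j , a≤j = blockStart i
      in suc (j + blockLength j a≤j) , m≤n⇒m≤1+n (≤-trans a≤j (m≤m+n j _))

    closesFrom⇒goodBlocks : ∃[ k ] (StrictlyIncreasing k × k 0 ≡ a × GoodBlocks k)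
    closesFrom⇒goodBlocks =
      (λ i → proj₁ (blockStart i)) , (λ i → s≤s (m≤m+n _ _)) , refl ,
      λ i → let j , a≤j = blockStart i
            in good⇒goodHistory (proj₂ (closesWithin⇒good (closes j a≤j)))

  fixWP⇔closesFrom : FixWP p λ′ π ⇔ (∃[ a ] ClosesFrom a)
  fixWP⇔closesFrom = mk⇔ to from
    where
    to : FixWP p λ′ π → ∃[ a ] ClosesFrom a
    to (a , dir) = a , λ j a≤j →
      let l , l<λ , wc = dir (j ∸ a)
      in l , l<λ , subst (λ x → WindowCond p π x l) (m+[n∸m]≡n a≤j)
                         (Equivalence.to (windowCond-shift p π a (j ∸ a) l) wc)
    from : ∃[ a ] ClosesFrom a → FixWP p λ′ π
    from (a , closes) = a , λ j →
      let l , l<λ , wc = closes (a + j) (m≤m+n a j)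
      in l , l<λ , Equivalence.from (windowCond-shift p π a j l) wc

lemma1 : (G : GameStructure) → (d : ℕ) → Even d
    → (p : Fin (GameStructure.n G) → ℕ) → (∀ v → p v ≤ d)
    → (λ′ : ℕ) → 1 ≤ λ′
    → (π : ℕ → Fin (GameStructure.n G)) → IsPlay G π
    → (FixWP p λ′ π ⇔ (∃[ k ] (StrictlyIncreasing k
    × (∀ i → GoodHistory p λ′ π (k i) (k (suc i) ∸ 1)))))
    × (DirFixWP p λ′ π ⇔ (∃[ k ] (StrictlyIncreasing k × k 0 ≡ 0
    × (∀ i → GoodHistory p λ′ π (k i) (k (suc i) ∸ 1)))))
lemma1 G d _ p _ λ′ _ π _ = mk⇔ fix⇒blocks blocks⇒fix , mk⇔ dir⇒blocks blocks⇒dir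
  where
  open Equivalence (fixWP⇔closesFrom p λ′ π)
  fix⇒blocks : FixWP p λ′ π → ∃[ k ] (StrictlyIncreasing k × GoodBlocks p λ′ π k)
  fix⇒blocks fix = let a , closes = to fix
                       k , inc , _ , good = closesFrom⇒goodBlocks p λ′ π closes
                   in k , inc , good
  blocks⇒fix : ∃[ k ] (StrictlyIncreasing k × GoodBlocks p λ′ π k) → FixWP p λ′ π
  blocks⇒fix (k , inc , good) = from (k 0 , goodBlocks⇒closesFrom p λ′ π inc good)
  dir⇒blocks : DirFixWP p λ′ π → ∃[ k ] (StrictlyIncreasing k × k 0 ≡ 0 × GoodBlocks p λ′ π k)
  dir⇒blocks dir = closesFrom⇒goodBlocks p λ′ π (λ j _ → dir j)
  blocks⇒dir : ∃[ k ] (StrictlyIncreasing k × k 0 ≡ 0 × GoodBlocks p λ′ π k) → DirFixWP p λ′ π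
  blocks⇒dir (k , inc , k0≡0 , good) j =
    goodBlocks⇒closesFrom p λ′ π inc good j (subst (_≤ j) (sym k0≡0) z≤n)
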